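{- Let $\mathrm{D}$ be one of $\mathrm{D.LE}$, $\mathrm{cfD.LE}$, an extension $\mathrm{D.LE}'$ of $\mathrm{D.LE}$ by analytic structural rules, or its cut-free version $\mathrm{cfD.LE}'$. Every functional $\mathrm{D}$-frame $\mathbb{F}_{\mathrm{D}}$ is an $\mathcal{L}$-frame.
   Context: LE-signature $\mathcal{L}=\mathcal{L}(\mathcal{F},\mathcal{G})$: disjoint sets of connectives, each $h$ with arity $n_h$ and order type $\varepsilon_h\in\{1,\partial\}^{n_h}$ ($1^\partial=\partial,\partial^\partial=1$). Formulas: $\varphi::=p\mid\bot\mid\top\mid\varphi\wedge\varphi\mid\varphi\vee\varphi\mid f(\bar\varphi)\mid g(\bar\varphi)$. $\bar a^i_b$: $\bar a$ with $i$-th entry replaced by $b$; $\bar a^i$: $\bar a$ with $i$-th entry removed. Residual symbols $f^\sharp_i$ ($f\in\mathcal{F}$, $1\le i\le n_f$) and $g^\flat_i$ ($g\in\mathcal{G}$); $\mathcal{F}^*$ = $\mathcal{F}$ plus $f^\sharp_i$ with $\varepsilon_f(i)=\partial$ plus $g^\flat_i$ with $\varepsilon_g(i)=1$; $\mathcal{G}^*$ = $\mathcal{G}$ plus $f^\sharp_i$ with $\varepsilon_f(i)=1$ plus $g^\flat_i$ with $\varepsilon_g(i)=\partial$; $\varepsilon_{f^\sharp_i}(i)=\varepsilon_f(i)$, and for $j\ne i$, $\varepsilon_{f^\sharp_i}(j)=\varepsilon_f(j)^\partial$ if $\varepsilon_f(i)=1$, $=\varepsilon_f(j)$ otherwise (likewise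 $g^\flat_i$). Structures: sorts $\mathsf{Str}_\mathcal{F},\mathsf{Str}_\mathcal{G}$ containing all formulas, closed under $\mathsf{F}_h$ ($h\in\mathcal{F}^*$; result in $\mathsf{Str}_\mathcal{F}$, argument $i$ in $\mathsf{Str}_\mathcal{F}$ if $\varepsilon_h(i)=1$, in $\mathsf{Str}_\mathcal{G}$ if $\partial$) and $\mathsf{G}_h$ ($h\in\mathcal{G}^*$; result in $\mathsf{Str}_\mathcal{G}$, argument $i$ in $\mathsf{Str}_\mathcal{G}$ if $\varepsilon_h(i)=1$, in $\mathsf{Str}_\mathcal{F}$ if $\partial$). Sequents: $x\Rightarrow y$, $x\in\mathsf{Str}_\mathcal{F}$, $y\in\mathsf{Str}_\mathcal{G}$. Rules of $\mathrm{D.LE}$: (Id) $p\Rightarrow p$; (Cut) from $x\Rightarrow\varphi$, $\varphi\Rightarrow y$ infer $x\Rightarrow y$; invertible display rules $\mathsf{F}_f(\bar x)\Rightarrow y$ iff $x_i\Rightarrow\mathsf{G}_{f^\sharp_i}(\bar x^i_y)$ ($\varepsilon_f(i)=1$); $\mathsf{F}_f(\bar x)\Rightarrow y$ iff $\mathsf{F}_{f^\sharp_i}(\bar x^i_y)\Rightarrow x_i$ ($\varepsilon_f(i)=\partial$); $x\Rightarrow\mathsf{G}_g(\bar y)$ iff $\mathsf{F}_{g^\flat_i}(\bar y^i_x)\Rightarrow y_i$ ($\varepsilon_g(i)=1$); $x\Rightarrow\mathsf{G}_g(\bar y)$ iff $y_i\Rightarrow\mathsf{G}_{g^\flat_i}(\bar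 y^i_x)$ ($\varepsilon_g(i)=\partial$); $\bot\Rightarrow y$; $x\Rightarrow\top$; $\wedge$-left ($\varphi\Rightarrow y$ / $\varphi\wedge\psi\Rightarrow y$ and $\psi\wedge\varphi\Rightarrow y$), $\vee$-right ($x\Rightarrow\varphi$ / $x\Rightarrow\varphi\vee\psi$ and $x\Rightarrow\psi\vee\varphi$), $\wedge$-right ($x\Rightarrow\varphi$, $x\Rightarrow\psi$ / $x\Rightarrow\varphi\wedge\psi$), $\vee$-left ($\varphi\Rightarrow y$, $\psi\Rightarrow y$ / $\varphi\vee\psi\Rightarrow y$); $\mathsf{F}_f(\bar\varphi)\Rightarrow y$ / $f(\bar\varphi)\Rightarrow y$; $x_i\Rightarrow\varphi_i$ ($\varepsilon_f(i)=1$), $\varphi_j\Rightarrow x_j$ ($\varepsilon_f(j)=\partial$) / $\mathsf{F}_f(\bar x)\Rightarrow f(\bar\varphi)$; $x\Rightarrow\mathsf{G}_g(\bar\psi)$ / $x\Rightarrow g(\bar\psi)$; $\psi_i\Rightarrow y_i$ ($\varepsilon_g(i)=1$), $y_j\Rightarrow\psi_j$ ($\varepsilon_g(j)=\partial$) / $g(\bar\psi)\Rightarrow\mathsf{G}_g(\bar y)$. $\mathrm{cfD.LE}$: without Cut. An analytic structural rule is a structural rule scheme (premises and conclusion built from sorted structure metavariables by structural connectives) satisfying Belnap's conditions C1–C7 for proper display calculi. Polarity, stability and $\mathcal{L}$-frames: for a polarity $(W,U,N)$, $X^\uparrow=\{u:xNu\ \forall x\in X\}$, $Y^\downarrow=\{w:wNy\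 \forall y\in Y\}$; $X\subseteq W$ stable iff $X=X^{\uparrow\downarrow}$, $Y\subseteq U$ stable iff $Y=Y^{\downarrow\uparrow}$; $W^\varepsilon=\prod_iW^{\varepsilon(i)}$ ($W^1=W,W^\partial=U$), $U^\varepsilon=\prod_iU^{\varepsilon(i)}$ ($U^1=U,U^\partial=W$). For $S\subseteq A\times B_1\times\cdots\times B_n$: $S^{(0)}[C_1,..,C_n]=\{a:(a,\bar b)\in S\ \forall b_j\in C_j\}$; $S^{(i)}[A',\bar C^i]=\{b\in B_i:(a,c_1,..,b,..,c_n)\in S\ \forall a\in A',c_j\in C_j\}$ (elements = singletons). An $\mathcal{L}$-frame is a polarity with $R_f\subseteq U\times W^{\varepsilon_f}$, $R_g\subseteq W\times U^{\varepsilon_g}$ such that $R_f^{(0)}[\bar w]$, $R_f^{(i)}[u_0,\bar w^i]$, $R_g^{(0)}[\bar u]$, $R_g^{(i)}[w_0,\bar u^i]$ are stable for all elements and coordinates. A functional $\mathrm{D}$-frame is $(W,U,N,\{R_f\},\{R_g\})$ with $W=\mathsf{Str}_\mathcal{F}$, $U=\mathsf{Str}_\mathcal{G}$, $N\subseteq W\times U$, $R_f(y,\bar x)$ iff $\mathsf{F}_f(\bar x)\,N\,y$ (for $f\in\mathcal{F}$, $\bar x\in W^{\varepsilon_f}$), $R_g(x,\bar y)$ iff $x\,N\,\mathsf{G}_g(\bar y)$ (for $g\in\mathcal{G}$, $\bar y\in U^{\varepsilon_g}$), and such that for every instance of a rule of $\mathrm{D}$ (including zero-premise rules) with premises $x_k\Rightarrow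 y_k$ and conclusion $x_0\Rightarrow y_0$: if $x_kNy_k$ for all $k$ then $x_0Ny_0$. -}

module Defs where

open import Data.Nat using (ℕ; _≟_; _≤_; _<_; _+_)
open import Data.Fin using (Fin; zero; suc)
open import Data.Vec using (Vec; []; _∷_; lookup; map; _[_]≔_)
open import Data.Vec.Properties using (lookup-map; map-[]≔; map-∘; map-cong)
open import Data.List using (List; []; _∷_; [_])
open import Data.Nat.ListAction using (sum)
import Data.List as List
open import Data.List.Relation.Unary.All using (All)
open import Data.Bool using (Bool; true; false; if_then_else_; _∧_)
open import Data.Product using (_×_; _,_)
open import Relation.Nullary using (Dec; yes; no; does)
open import Relation.Binary.PropositionalEquality
  using (_≡_; refl; sym; trans; cong; subst)
open import Function.Bundles using (_⇔_)

-- the two values 1 and ∂ of an order-type coordinate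
data Pol : Set where
  one : Pol
  ∂   : Pol

_ᵖ : Pol → Pol
one ᵖ = ∂
∂ ᵖ   = one

-- LE-signatures L = L(F, G).  F and G are disjoint by being distinct
-- types; each connective has an arity and an order type in {1,∂}^n.

record Signature : Set₁ where
  field
    Atom : Set
    FC   : Set
    GC   : Set
    arF  : FC → ℕ
    arG  : GC → ℕ
    εF   : (f : FC) → Vec Pol (arF f)
    εG   : (g : GC) → Vec Pol (arG g)

data Sort : Set where
  𝔽 𝔾 : Sort

_≟S_ : (s t : Sort) → Dec (s ≡ t)
𝔽 ≟S 𝔽 = yes refl
𝔽 ≟S 𝔾 = no (λ ())
𝔾 ≟S 𝔽 = no (λ ())
𝔾 ≟S 𝔾 = yes refl

-- sort of the i-th argument of an F-structural connective:
-- Str_F if ε(i) = 1, Str_G if ε(i) = ∂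
argF : Pol → Sort
argF one = 𝔽
argF ∂   = 𝔾

-- sort of the i-th argument of a G-structural connective:
-- Str_G if ε(i) = 1, Str_F if ε(i) = ∂
argG : Pol → Sort
argG one = 𝔾
argG ∂   = 𝔽

-- order type of a residual h♯_i / h♭_i of a connective of order type ε:
-- coordinate i keeps ε(i); for j ≠ i, ε(j)^∂ if ε(i) = 1, ε(j) otherwise.
twist : Pol → Pol → Pol
twist one e = e ᵖ
twist ∂   e = e

ε♯ : ∀ {n} → Vec Pol n → Fin n → Vec Pol n
ε♯ ε i = map (twist (lookup ε i)) ε [ i ]≔ lookup ε i

-- Dependent tuples (elements of products ∏_i C(s_i))

data Tuple (C : Sort → Set) : ∀ {n} → Vec Sort n → Set where
  []  : Tuple C []
  _∷_ : ∀ {s n} {ss : Vec Sort n} → C s → Tuple C ss → Tuple C (s ∷ ss)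

lookupT : ∀ {C n} {ss : Vec Sort n} → Tuple C ss → (i : Fin n) → C (lookup ss i)
lookupT (x ∷ xs) zero    = x
lookupT (x ∷ xs) (suc i) = lookupT xs i

updT : ∀ {C n} {ss : Vec Sort n} → Tuple C ss → (i : Fin n) → C (lookup ss i) → Tuple C ss
updT (x ∷ xs) zero    b = b ∷ xs
updT (x ∷ xs) (suc i) b = x ∷ updT xs i b

setT : ∀ {C n s} {ss : Vec Sort n} → Tuple C ss → (i : Fin n) → C s → Tuple C (ss [ i ]≔ s)
setT (x ∷ xs) zero    b = b ∷ xs
setT (x ∷ xs) (suc i) b = x ∷ setT xs i b

-- Equalities of sort vectors needed to type the display rules

private
  lemTw : ∀ {n} (k h : Pol → Sort) (t : Pol → Pol) → (∀ e → k (t e) ≡ h e) →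
          (ε : Vec Pol n) (i : Fin n) (c : Pol) →
          map k (map t ε [ i ]≔ c) ≡ map h ε [ i ]≔ k c
  lemTw k h t kt ε i c =
    trans (map-[]≔ k (map t ε) i)
          (cong (λ v → v [ i ]≔ k c) (trans (sym (map-∘ k t ε)) (map-cong kt ε)))

  argG-ᵖ : ∀ e → argG (e ᵖ) ≡ argF e
  argG-ᵖ one = refl
  argG-ᵖ ∂   = refl

  argF-ᵖ : ∀ e → argF (e ᵖ) ≡ argG e
  argF-ᵖ one = refl
  argF-ᵖ ∂   = refl

-- f ∈ F, ε_f(i) = 1 : f♯_i ∈ G*
sortsF1 : ∀ {n} (ε : Vec Pol n) (i : Fin n) → lookup ε i ≡ one →
          map argF ε [ i ]≔ 𝔾 ≡ map argG (ε♯ ε i)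
sortsF1 ε i p rewrite p = sym (lemTw argG argF _ᵖ argG-ᵖ ε i one)

-- f ∈ F, ε_f(i) = ∂ : f♯_i ∈ F*
sortsF∂ : ∀ {n} (ε : Vec Pol n) (i : Fin n) → lookup ε i ≡ ∂ →
          map argF ε [ i ]≔ 𝔾 ≡ map argF (ε♯ ε i)
sortsF∂ ε i p rewrite p = sym (lemTw argF argF (λ e → e) (λ _ → refl) ε i ∂)

-- g ∈ G, ε_g(i) = 1 : g♭_i ∈ F*
sortsG1 : ∀ {n} (ε : Vec Pol n) (i : Fin n) → lookup ε i ≡ one →
          map argG ε [ i ]≔ 𝔽 ≡ map argF (ε♯ ε i)
sortsG1 ε i p rewrite p = sym (lemTw argF argG _ᵖ argF-ᵖ ε i one)

-- g ∈ G, ε_g(i) = ∂ : g♭_i ∈ G*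
sortsG∂ : ∀ {n} (ε : Vec Pol n) (i : Fin n) → lookup ε i ≡ ∂ →
          map argG ε [ i ]≔ 𝔽 ≡ map argG (ε♯ ε i)
sortsG∂ ε i p rewrite p = sym (lemTw argG argG (λ e → e) (λ _ → refl) ε i ∂)

lookF : ∀ {n} (ε : Vec Pol n) (i : Fin n) {e : Pol} → lookup ε i ≡ e →
        lookup (map argF ε) i ≡ argF e
lookF ε i p = trans (lookup-map i argF ε) (cong argF p)

lookG : ∀ {n} (ε : Vec Pol n) (i : Fin n) {e : Pol} → lookup ε i ≡ e →
        lookup (map argG ε) i ≡ argG e
lookG ε i p = trans (lookup-map i argG ε) (cong argG p)

module LE (L : Signature) where
  open Signature L public

  infixr 6 _∧ᶠ_
  infixr 5 _∨ᶠ_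

  data Fm : Set where
    var        : Atom → Fm
    ⊥ᶠ ⊤ᶠ      : Fm
    _∧ᶠ_ _∨ᶠ_  : Fm → Fm → Fm
    fapp       : (f : FC) → Vec Fm (arF f) → Fm
    gapp       : (g : GC) → Vec Fm (arG g) → Fm

  data FStar : Set where
    origF : FC → FStar
    f♯    : (f : FC) (i : Fin (arF f)) → lookup (εF f) i ≡ ∂ → FStar
    g♭    : (g : GC) (i : Fin (arG g)) → lookup (εG g) i ≡ one → FStar

  data GStar : Set where
    origG : GC → GStar
    f♯    : (f : FC) (i : Fin (arF f)) → lookup (εF f) i ≡ one → GStar
    g♭    : (g : GC) (i : Fin (arG g)) → lookup (εG g) i ≡ ∂ → GStar

  arFS : FStar → ℕ
  arFS (origF f)   = arF f
  arFS (f♯ f i _)  = arF f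
  arFS (g♭ g i _)  = arG g

  εFS : (h : FStar) → Vec Pol (arFS h)
  εFS (origF f)  = εF f
  εFS (f♯ f i _) = ε♯ (εF f) i
  εFS (g♭ g i _) = ε♯ (εG g) i

  arGS : GStar → ℕ
  arGS (origG g)   = arG g
  arGS (f♯ f i _)  = arF f
  arGS (g♭ g i _)  = arG g

  εGS : (h : GStar) → Vec Pol (arGS h)
  εGS (origG g)  = εG g
  εGS (f♯ f i _) = ε♯ (εF f) i
  εGS (g♭ g i _) = ε♯ (εG g) i

  data Str : Sort → Set where
    fm : ∀ {s} → Fm → Str s
    Fs : (h : FStar) → Tuple Str (map argF (εFS h)) → Str 𝔽
    Gs : (h : GStar) → Tuple Str (map argG (εGS h)) → Str 𝔾

  record Seq : Set where
    constructor _⇒_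
    field
      ant : Str 𝔽
      sucd : Str 𝔾
  open Seq public

  fmT : ∀ {n} (ss : Vec Sort n) → Vec Fm n → Tuple Str ss
  fmT []       []       = []
  fmT (s ∷ ss) (φ ∷ φs) = fm φ ∷ fmT ss φs

  fRprems : ∀ {n} (ε : Vec Pol n) → Tuple Str (map argF ε) → Vec Fm n → List Seq
  fRprems []        []       []       = []
  fRprems (one ∷ ε) (x ∷ xs) (φ ∷ φs) = (x ⇒ fm φ) ∷ fRprems ε xs φs
  fRprems (∂ ∷ ε)   (x ∷ xs) (φ ∷ φs) = (fm φ ⇒ x) ∷ fRprems ε xs φs

  gLprems : ∀ {n} (ε : Vec Pol n) → Tuple Str (map argG ε) → Vec Fm n → List Seq
  gLprems []        []       []       = []
  gLprems (one ∷ ε) (y ∷ ys) (ψ ∷ ψs) = (fm ψ ⇒ y) ∷ gLprems ε ys ψs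
  gLprems (∂ ∷ ε)   (y ∷ ys) (ψ ∷ ψs) = (y ⇒ fm ψ) ∷ gLprems ε ys ψs

  -- f with ε_f(i) = 1 :  F_f(x̄) ⇒ y  iff  x_i ⇒ G_{f♯_i}(x̄^i_y)
  dF1-x : (f : FC) (i : Fin (arF f)) (p : lookup (εF f) i ≡ one) →
          Tuple Str (map argF (εF f)) → Str 𝔽
  dF1-x f i p xs = subst Str (lookF (εF f) i p) (lookupT xs i)
  dF1-r : (f : FC) (i : Fin (arF f)) (p : lookup (εF f) i ≡ one) →
          Tuple Str (map argF (εF f)) → Str 𝔾 → Str 𝔾
  dF1-r f i p xs y = Gs (f♯ f i p) (subst (Tuple Str) (sortsF1 (εF f) i p) (setT xs i y))

  -- f with ε_f(i) = ∂ :  F_f(x̄) ⇒ y  iff  F_{f♯_i}(x̄^i_y) ⇒ x_i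
  dF∂-x : (f : FC) (i : Fin (arF f)) (p : lookup (εF f) i ≡ ∂) →
          Tuple Str (map argF (εF f)) → Str 𝔾
  dF∂-x f i p xs = subst Str (lookF (εF f) i p) (lookupT xs i)
  dF∂-r : (f : FC) (i : Fin (arF f)) (p : lookup (εF f) i ≡ ∂) →
          Tuple Str (map argF (εF f)) → Str 𝔾 → Str 𝔽
  dF∂-r f i p xs y = Fs (f♯ f i p) (subst (Tuple Str) (sortsF∂ (εF f) i p) (setT xs i y))

  -- g with ε_g(i) = 1 :  x ⇒ G_g(ȳ)  iff  F_{g♭_i}(ȳ^i_x) ⇒ y_i
  dG1-y : (g : GC) (i : Fin (arG g)) (p : lookup (εG g) i ≡ one) →
          Tuple Str (map argG (εG g)) → Str 𝔾
  dG1-y g i p ys = subst Str (lookG (εG g) i p) (lookupT ys i)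
  dG1-r : (g : GC) (i : Fin (arG g)) (p : lookup (εG g) i ≡ one) →
          Tuple Str (map argG (εG g)) → Str 𝔽 → Str 𝔽
  dG1-r g i p ys x = Fs (g♭ g i p) (subst (Tuple Str) (sortsG1 (εG g) i p) (setT ys i x))

  -- g with ε_g(i) = ∂ :  x ⇒ G_g(ȳ)  iff  y_i ⇒ G_{g♭_i}(ȳ^i_x)
  dG∂-y : (g : GC) (i : Fin (arG g)) (p : lookup (εG g) i ≡ ∂) →
          Tuple Str (map argG (εG g)) → Str 𝔽
  dG∂-y g i p ys = subst Str (lookG (εG g) i p) (lookupT ys i)
  dG∂-r : (g : GC) (i : Fin (arG g)) (p : lookup (εG g) i ≡ ∂) →
          Tuple Str (map argG (εG g)) → Str 𝔽 → Str 𝔾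
  dG∂-r g i p ys x = Gs (g♭ g i p) (subst (Tuple Str) (sortsG∂ (εG g) i p) (setT ys i x))

  -- structural rule schemes: built from sorted structure metavariables
  -- (mv n of sort s) by the structural connectives F_h, G_h

  data Term : Sort → Set where
    mv : ∀ {s} → ℕ → Term s
    Ft : (h : FStar) → Tuple Term (map argF (εFS h)) → Term 𝔽
    Gt : (h : GStar) → Tuple Term (map argG (εGS h)) → Term 𝔾

  record TSeq : Set where
    constructor _⇒ₜ_
    field
      antₜ : Term 𝔽
      sucₜ : Term 𝔾

  record Scheme : Set where
    field
      premises   : List TSeq
      conclusion : TSeq
  open Scheme public

  Subst : Set
  Subst = (s : Sort) → ℕ → Str s

  mutual
    inst : ∀ {s} → Subst → Term s → Str s
    inst σ (mv {s} n) = σ s n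
    inst σ (Ft h ts)  = Fs h (instT σ ts)
    inst σ (Gt h ts)  = Gs h (instT σ ts)

    instT : ∀ {n} {ss : Vec Sort n} → Subst → Tuple Term ss → Tuple Str ss
    instT σ []       = []
    instT σ (t ∷ ts) = inst σ t ∷ instT σ ts

  instS : Subst → TSeq → Seq
  instS σ (a ⇒ₜ b) = inst σ a ⇒ inst σ b

  mutual
    occ : Sort → ℕ → ∀ {t} → Term t → ℕ
    occ s m (mv {t} n) = if does (s ≟S t) ∧ does (m ≟ n) then 1 else 0
    occ s m (Ft h ts)  = occT s m ts
    occ s m (Gt h ts)  = occT s m ts

    occT : Sort → ℕ → ∀ {n} {ss : Vec Sort n} → Tuple Term ss → ℕ
    occT s m []       = 0
    occT s m (t ∷ ts) = occ s m t + occT s m ts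

  occS : Sort → ℕ → TSeq → ℕ
  occS s m (a ⇒ₜ b) = occ s m a + occ s m b

  -- Belnap's conditions C1–C7 for a structural rule scheme of this
  -- sorted language: C1 every metavariable of a premise
  -- occurs in the conclusion; C3 (non-proliferation) every metavariable
  -- occurs at most once in the conclusion.  C2, C4 (sort = antecedent /
  -- succedent position), C5 (no principal formulas), C6, C7 (closure
  -- under substitution of schemes) hold automatically.
  record Analytic (ρ : Scheme) : Set where
    field
      C1 : ∀ s m → 0 < sum (List.map (occS s m) (premises ρ)) → 0 < occS s m (conclusion ρ)
      C3 : ∀ s m → occS s m (conclusion ρ) ≤ 1

  -- the rules of D: D.LE (cut = true) / cfD.LE (cut = false), extended by
  -- the structural rule schemes ℛ k (k : I).
  -- Rule cut ℛ premises conclusion  =  an instance of a rule of D.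

  data Rule (cut : Bool) {I : Set} (ℛ : I → Scheme) : List Seq → Seq → Set where
    Id    : (p : Atom) → Rule cut ℛ [] (fm (var p) ⇒ fm (var p))
    Cut   : cut ≡ true → (x : Str 𝔽) (φ : Fm) (y : Str 𝔾) →
            Rule cut ℛ ((x ⇒ fm φ) ∷ (fm φ ⇒ y) ∷ []) (x ⇒ y)
    dF1→  : ∀ f i p xs y → Rule cut ℛ [ Fs (origF f) xs ⇒ y ] (dF1-x f i p xs ⇒ dF1-r f i p xs y)
    dF1←  : ∀ f i p xs y → Rule cut ℛ [ dF1-x f i p xs ⇒ dF1-r f i p xs y ] (Fs (origF f) xs ⇒ y)
    dF∂→  : ∀ f i p xs y → Rule cut ℛ [ Fs (origF f) xs ⇒ y ] (dF∂-r f i p xs y ⇒ dF∂-x f i p xs)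
    dF∂←  : ∀ f i p xs y → Rule cut ℛ [ dF∂-r f i p xs y ⇒ dF∂-x f i p xs ] (Fs (origF f) xs ⇒ y)
    dG1→  : ∀ g i p ys x → Rule cut ℛ [ x ⇒ Gs (origG g) ys ] (dG1-r g i p ys x ⇒ dG1-y g i p ys)
    dG1←  : ∀ g i p ys x → Rule cut ℛ [ dG1-r g i p ys x ⇒ dG1-y g i p ys ] (x ⇒ Gs (origG g) ys)
    dG∂→  : ∀ g i p ys x → Rule cut ℛ [ x ⇒ Gs (origG g) ys ] (dG∂-y g i p ys ⇒ dG∂-r g i p ys x)
    dG∂←  : ∀ g i p ys x → Rule cut ℛ [ dG∂-y g i p ys ⇒ dG∂-r g i p ys x ] (x ⇒ Gs (origG g) ys)
    ⊥L    : (y : Str 𝔾) → Rule cut ℛ [] (fm ⊥ᶠ ⇒ y)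
    ⊤R    : (x : Str 𝔽) → Rule cut ℛ [] (x ⇒ fm ⊤ᶠ)
    ∧L₁   : ∀ φ ψ y → Rule cut ℛ [ fm φ ⇒ y ] (fm (φ ∧ᶠ ψ) ⇒ y)
    ∧L₂   : ∀ φ ψ y → Rule cut ℛ [ fm φ ⇒ y ] (fm (ψ ∧ᶠ φ) ⇒ y)
    ∨R₁   : ∀ φ ψ x → Rule cut ℛ [ x ⇒ fm φ ] (x ⇒ fm (φ ∨ᶠ ψ))
    ∨R₂   : ∀ φ ψ x → Rule cut ℛ [ x ⇒ fm φ ] (x ⇒ fm (ψ ∨ᶠ φ))
    ∧R    : ∀ φ ψ x → Rule cut ℛ ((x ⇒ fm φ) ∷ (x ⇒ fm ψ) ∷ []) (x ⇒ fm (φ ∧ᶠ ψ))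
    ∨L    : ∀ φ ψ y → Rule cut ℛ ((fm φ ⇒ y) ∷ (fm ψ ⇒ y) ∷ []) (fm (φ ∨ᶠ ψ) ⇒ y)
    fL    : ∀ f φs y → Rule cut ℛ [ Fs (origF f) (fmT _ φs) ⇒ y ] (fm (fapp f φs) ⇒ y)
    fR    : ∀ f xs φs → Rule cut ℛ (fRprems (εF f) xs φs) (Fs (origF f) xs ⇒ fm (fapp f φs))
    gR    : ∀ g ψs x → Rule cut ℛ [ x ⇒ Gs (origG g) (fmT _ ψs) ] (x ⇒ fm (gapp g ψs))
    gL    : ∀ g ψs ys → Rule cut ℛ (gLprems (εG g) ys ψs) (fm (gapp g ψs) ⇒ Gs (origG g) ys)
    str   : (k : I) (σ : Subst) →
            Rule cut ℛ (List.map (instS σ) (premises (ℛ k))) (instS σ (conclusion (ℛ k)))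

  -- functional D-frames: W = Str_F, U = Str_G

  record IsFunctionalDFrame (cut : Bool) {I : Set} (ℛ : I → Scheme)
           (N  : Str 𝔽 → Str 𝔾 → Set)
           (Rf : (f : FC) → Str 𝔾 → Tuple Str (map argF (εF f)) → Set)
           (Rg : (g : GC) → Str 𝔽 → Tuple Str (map argG (εG g)) → Set) : Set where
    field
      Rf-def : ∀ f y xs → Rf f y xs ⇔ N (Fs (origF f) xs) y
      Rg-def : ∀ g x ys → Rg g x ys ⇔ N x (Gs (origG g) ys)
      closed : ∀ {ps c} → Rule cut ℛ ps c →
               All (λ q → N (ant q) (sucd q)) ps → N (ant c) (sucd c)

  -- L-frames.  A polarity (W, U, N) is given as W = Car 𝔽, U = Car 𝔾;
  -- W^ε = ∏_i W^{ε(i)} = Tuple Car (map argF ε), U^ε = Tuple Car (map argG ε).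

  module Polarity (Car : Sort → Set) (N : Car 𝔽 → Car 𝔾 → Set) where
    _↑ : (Car 𝔽 → Set) → Car 𝔾 → Set
    (X ↑) u = ∀ x → X x → N x u

    _↓ : (Car 𝔾 → Set) → Car 𝔽 → Set
    (Y ↓) w = ∀ y → Y y → N w y

    StableW : (Car 𝔽 → Set) → Set
    StableW X = ∀ w → X w ⇔ ((X ↑) ↓) w

    StableU : (Car 𝔾 → Set) → Set
    StableU Y = ∀ u → Y u ⇔ ((Y ↓) ↑) u

    Stable : (s : Sort) → (Car s → Set) → Set
    Stable 𝔽 = StableW
    Stable 𝔾 = StableU

  record IsLFrame (Car : Sort → Set) (N : Car 𝔽 → Car 𝔾 → Set)
           (Rf : (f : FC) → Car 𝔾 → Tuple Car (map argF (εF f)) → Set)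
           (Rg : (g : GC) → Car 𝔽 → Tuple Car (map argG (εG g)) → Set) : Set where
    open Polarity Car N
    field
      Rf0 : ∀ f (ws : Tuple Car (map argF (εF f))) → StableU (λ u → Rf f u ws)
      Rfi : ∀ f (i : Fin (arF f)) (u₀ : Car 𝔾) (ws : Tuple Car (map argF (εF f))) →
            Stable (lookup (map argF (εF f)) i) (λ b → Rf f u₀ (updT ws i b))
      Rg0 : ∀ g (us : Tuple Car (map argG (εG g))) → StableW (λ w → Rg g w us)
      Rgi : ∀ g (i : Fin (arG g)) (w₀ : Car 𝔽) (us : Tuple Car (map argG (εG g))) →
            Stable (lookup (map argG (εG g)) i) (λ b → Rg g w₀ (updT us i b))

module Submission where

-- In a polarity (W, U, N) every "principal" set {w | w N c} ⊆ W,
-- and dually {u | c N u} ⊆ U, is stable: it is the closure of itself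
-- because c lies in its polar.  So it suffices to show that each of the
-- sets R_f^(0)[w̄], R_f^(i)[u₀, w̄^i], R_g^(0)[ū], R_g^(i)[w₀, ū^i] of a
-- functional D-frame is principal.  For the 0-th coordinate this is the
-- definition of R_f, R_g (R_f(u, w̄) iff F_f(w̄) N u).  For the i-th
-- coordinate we use that N is closed under the invertible display rules
-- of D, present in all four calculi: they display x_i as the whole
-- antecedent (or succedent) of a sequent whose other side does not depend
-- on x_i, so the set is principal, generated by that other side.

open import Defs
open import Data.Bool using (Bool)
import Data.Vec
open import Data.Vec using (Vec; lookup; map)
open import Data.Fin using (Fin; zero; suc)
open import Data.List using ([_])
open import Data.List.Relation.Unary.All using ([]; _∷_)
open import Function.Bundles using (_⇔_; mk⇔; Equivalence)
open import Function.Construct.Composition using (_⇔-∘_)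
open import Relation.Binary.PropositionalEquality
  using (_≡_; refl; cong; cong₂; subst)

lookupT-updT : ∀ {C n} {ss : Vec Sort n} (xs : Tuple C ss) (i : Fin n) (b : C (lookup ss i)) →
  lookupT (updT xs i b) i ≡ b
lookupT-updT (x ∷ xs) zero    b = refl
lookupT-updT (x ∷ xs) (suc i) b = lookupT-updT xs i b

-- Overwriting entry i forgets what entry i held before: x̄^i_y does not
-- depend on x_i.
setT-updT : ∀ {C n s} {ss : Vec Sort n} (xs : Tuple C ss) (i : Fin n) (b : C (lookup ss i)) (y : C s) →
  setT (updT xs i b) i y ≡ setT xs i y
setT-updT (x ∷ xs) zero    b y = refl
setT-updT (x ∷ xs) (suc i) b y = cong (x ∷_) (setT-updT xs i b y)

≡⇒⇔ : ∀ {A B : Set} → A ≡ B → A ⇔ B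
≡⇒⇔ refl = mk⇔ (λ a → a) (λ a → a)

module PrincipalSets (L : Signature) (Car : Sort → Set) (N : Car 𝔽 → Car 𝔾 → Set) where
  open LE.Polarity L Car N
  open Equivalence

  -- {w | w N c} is stable: any w in its closure relates to c ∈ {w | w N c}↑.
  principal-stableW : (X : Car 𝔽 → Set) (c : Car 𝔾) → (∀ w → X w ⇔ N w c) → StableW X
  principal-stableW X c X≡Nc w =
    mk⇔ (λ Xw u X↑u → X↑u w Xw)
        (λ w∈X↑↓ → from (X≡Nc w) (w∈X↑↓ c (λ x Xx → to (X≡Nc x) Xx)))

  principal-stableU : (Y : Car 𝔾 → Set) (c : Car 𝔽) → (∀ u → Y u ⇔ N c u) → StableU Y
  principal-stableU Y c Y≡cN u =
    mk⇔ (λ Yu w Y↓w → Y↓w u Yu)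
        (λ u∈Y↓↑ → from (Y≡cN u) (u∈Y↓↑ c (λ y Yy → to (Y≡cN y) Yy)))

  -- The same for a set over a sort s only known to equal 𝔽 (resp. 𝔾), as
  -- happens for the i-th argument sort of a connective.
  principal-stable𝔽 : ∀ {s} (q : s ≡ 𝔽) (P : Car s → Set) (c : Car 𝔾) →
                      (∀ b → P b ⇔ N (subst Car q b) c) → Stable s P
  principal-stable𝔽 refl = principal-stableW

  principal-stable𝔾 : ∀ {s} (q : s ≡ 𝔾) (P : Car s → Set) (c : Car 𝔽) →
                      (∀ b → P b ⇔ N c (subst Car q b)) → Stable s P
  principal-stable𝔾 refl = principal-stableU

module FunctionalFrame (L : Signature) (cut : Bool) (I : Set) (ℛ : I → LE.Scheme L)
    (N : LE.Str L 𝔽 → LE.Str L 𝔾 → Set)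
    (Rf : (f : Signature.FC L) → LE.Str L 𝔾 → Tuple (LE.Str L) (Data.Vec.map argF (Signature.εF L f)) → Set)
    (Rg : (g : Signature.GC L) → LE.Str L 𝔽 → Tuple (LE.Str L) (Data.Vec.map argG (Signature.εG L g)) → Set)
    (D : LE.IsFunctionalDFrame L cut ℛ N Rf Rg) where
  open LE L
  open IsFunctionalDFrame D

  invertible⇔ : ∀ {a b c d} → Rule cut ℛ [ a ⇒ b ] (c ⇒ d) → Rule cut ℛ [ c ⇒ d ] (a ⇒ b) →
                N a b ⇔ N c d
  invertible⇔ down up = mk⇔ (λ n → closed down (n ∷ [])) (λ n → closed up (n ∷ []))

  display-F1 : ∀ f i (p : lookup (εF f) i ≡ one) ws u b →
    N (Fs (origF f) (updT ws i b)) u ⇔ N (subst Str (lookF (εF f) i p) b) (dF1-r f i p ws u)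
  display-F1 f i p ws u b =
    ≡⇒⇔ (cong₂ N (cong (subst Str (lookF (εF f) i p)) (lookupT-updT ws i b))
                 (cong (λ t → Gs (f♯ f i p) (subst (Tuple Str) (sortsF1 (εF f) i p) t)) (setT-updT ws i b u)))
    ⇔-∘ invertible⇔ (dF1→ f i p (updT ws i b) u) (dF1← f i p (updT ws i b) u)

  display-F∂ : ∀ f i (p : lookup (εF f) i ≡ ∂) ws u b →
    N (Fs (origF f) (updT ws i b)) u ⇔ N (dF∂-r f i p ws u) (subst Str (lookF (εF f) i p) b)
  display-F∂ f i p ws u b =
    ≡⇒⇔ (cong₂ N (cong (λ t → Fs (f♯ f i p) (subst (Tuple Str) (sortsF∂ (εF f) i p) t)) (setT-updT ws i b u))
                 (cong (subst Str (lookF (εF f) i p)) (lookupT-updT ws i b)))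
    ⇔-∘ invertible⇔ (dF∂→ f i p (updT ws i b) u) (dF∂← f i p (updT ws i b) u)

  display-G1 : ∀ g i (p : lookup (εG g) i ≡ one) us w b →
    N w (Gs (origG g) (updT us i b)) ⇔ N (dG1-r g i p us w) (subst Str (lookG (εG g) i p) b)
  display-G1 g i p us w b =
    ≡⇒⇔ (cong₂ N (cong (λ t → Fs (g♭ g i p) (subst (Tuple Str) (sortsG1 (εG g) i p) t)) (setT-updT us i b w))
                 (cong (subst Str (lookG (εG g) i p)) (lookupT-updT us i b)))
    ⇔-∘ invertible⇔ (dG1→ g i p (updT us i b) w) (dG1← g i p (updT us i b) w)

  display-G∂ : ∀ g i (p : lookup (εG g) i ≡ ∂) us w b →
    N w (Gs (origG g) (updT us i b)) ⇔ N (subst Str (lookG (εG g) i p) b) (dG∂-r g i p us w)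
  display-G∂ g i p us w b =
    ≡⇒⇔ (cong₂ N (cong (subst Str (lookG (εG g) i p)) (lookupT-updT us i b))
                 (cong (λ t → Gs (g♭ g i p) (subst (Tuple Str) (sortsG∂ (εG g) i p) t)) (setT-updT us i b w)))
    ⇔-∘ invertible⇔ (dG∂→ g i p (updT us i b) w) (dG∂← g i p (updT us i b) w)

  open PrincipalSets L Str N
  open LE.Polarity L Str N

  Rf0-stable : ∀ f ws → StableU (λ u → Rf f u ws)
  Rf0-stable f ws = principal-stableU _ (Fs (origF f) ws) (λ u → Rf-def f u ws)

  Rg0-stable : ∀ g us → StableW (λ w → Rg g w us)
  Rg0-stable g us = principal-stableW _ (Gs (origG g) us) (λ w → Rg-def g w us)

  Rfi-stable : ∀ f (i : Fin (arF f)) u₀ ws →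
               Stable (lookup (map argF (εF f)) i) (λ b → Rf f u₀ (updT ws i b))
  Rfi-stable f i u₀ ws with lookup (εF f) i in p
  ... | one = principal-stable𝔽 (lookF (εF f) i p) _ (dF1-r f i p ws u₀)
                (λ b → display-F1 f i p ws u₀ b ⇔-∘ Rf-def f u₀ (updT ws i b))
  ... | ∂   = principal-stable𝔾 (lookF (εF f) i p) _ (dF∂-r f i p ws u₀)
                (λ b → display-F∂ f i p ws u₀ b ⇔-∘ Rf-def f u₀ (updT ws i b))

  Rgi-stable : ∀ g (i : Fin (arG g)) w₀ us →
               Stable (lookup (map argG (εG g)) i) (λ b → Rg g w₀ (updT us i b))
  Rgi-stable g i w₀ us with lookup (εG g) i in p
  ... | one = principal-stable𝔾 (lookG (εG g) i p) _ (dG1-r g i p us w₀)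
                (λ b → display-G1 g i p us w₀ b ⇔-∘ Rg-def g w₀ (updT us i b))
  ... | ∂   = principal-stable𝔽 (lookG (εG g) i p) _ (dG∂-r g i p us w₀)
                (λ b → display-G∂ g i p us w₀ b ⇔-∘ Rg-def g w₀ (updT us i b))

-- Proposition 4.3.
proposition4p3 : (L : Signature) (cut : Bool) (I : Set) (ℛ : I → LE.Scheme L) →
    (∀ k → LE.Analytic L (ℛ k)) →
    (N : LE.Str L 𝔽 → LE.Str L 𝔾 → Set) →
    (Rf : (f : Signature.FC L) → LE.Str L 𝔾 → Tuple (LE.Str L) (Data.Vec.map argF (Signature.εF L f)) → Set) →
    (Rg : (g : Signature.GC L) → LE.Str L 𝔽 → Tuple (LE.Str L) (Data.Vec.map argG (Signature.εG L g)) → Set) →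
    LE.IsFunctionalDFrame L cut ℛ N Rf Rg →
    LE.IsLFrame L (LE.Str L) N Rf Rg
proposition4p3 L cut I ℛ _ N Rf Rg D = record
  { Rf0 = Rf0-stable ; Rfi = Rfi-stable ; Rg0 = Rg0-stable ; Rgi = Rgi-stable }
  where open FunctionalFrame L cut I ℛ N Rf Rg D
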